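{- Let $\phi$ be an $\mathsf{LTL}_f$ formula. Then $\phi$ is unsatisfiable if and only if there exist a conflict sequence $\mathcal{C}$ of $T_\phi$ and an integer $i\ge 0$ with $i+1<|\mathcal{C}|$ such that $\bigcap_{0\le j\le i}\mathcal{C}[j]\subseteq \mathcal{C}[i+1]$.
   Context: $\mathsf{LTL}_f$ is linear temporal logic interpreted over finite nonempty traces over a finite set $P$ of atoms; $\phi$ is satisfiable iff some finite nonempty trace satisfies it. $Tail$ denotes the formula that holds exactly at the last position of a trace. For a formula $\psi$, $\mathrm{xnf}(\psi)$ is its neXt normal form, an $\mathsf{LTL}_f$ formula equivalent to $\psi$ (possibly containing $Tail$) in which every temporal subformula occurs in the scope of a next operator $\mathsf{X}$; for a set $s$ of formulas, $\mathrm{xnf}(s)=\bigwedge_{\psi\in s}\mathrm{xnf}(\psi)$. For a formula $\theta$, $\theta^p$ is its propositional abstraction, obtained by treating each subformula of the form $\mathsf{X}\chi$ (and $Tail$) as a fresh Boolean variable. The transition system $T_\phi$ has as states finite sets of subformula-derived $\mathsf{LTL}_f$ formulas (each state read as the conjunction of its elements; there are finitely many reachable states), initial state $s_0=\{\phi\}$, and a transition $s\to s'$ whenever there is a satisfying assignment $A$ of $\mathrm{xnf}(s)^p$ with $s'=\{\chi : \text{the variable for } \mathsf{X}\chi \text{ is true in } A\}$; $s'$ is then a one-transition next state of $s$. A state $s$ is final iff $Tail\wedge \mathrm{xnf}(s)^p$ is satisfiable. It is a known property of $T_\phi$ that $\phi$ is satisfiable iff some run of $T_\phi$ from $s_0$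 ends in a final state. A conflict sequence for $T_\phi$ is a finite nonempty sequence $\mathcal{C}[0],\ldots,\mathcal{C}[|\mathcal{C}|-1]$ of sets of states of $T_\phi$ such that: (1) $s_0\in\mathcal{C}[i]$ for all $0\le i<|\mathcal{C}|$; (2) no state in $\mathcal{C}[0]$ is final; (3) for every $0\le i<|\mathcal{C}|-1$ and every $s\in\mathcal{C}[i+1]$, all one-transition next states of $s$ belong to $\mathcal{C}[i]$. -}

module Defs where

open import Data.Nat using (ℕ; zero; suc; _≤_; _<_)
open import Data.Fin using (Fin)
open import Data.Bool using (Bool; true; false; not; _∧_; _∨_)
open import Data.List using (List; []; _∷_; _++_; [_]; foldr; map)
open import Data.List.Membership.Propositional using (_∈_)
open import Data.Product using (Σ; _×_; _,_)
open import Data.Sum using (_⊎_)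
open import Data.Unit using (⊤)
open import Data.Empty using (⊥)
open import Relation.Nullary using (¬_)
open import Relation.Binary.PropositionalEquality using (_≡_)
open import Function.Bundles using (_⇔_)

-- LTL_f formulas in negation normal form over the atoms P = Fin n.
-- X is the strong next, N the weak next, U until, R release.

infixr 6 _∧ᶠ_
infixr 5 _∨ᶠ_
infixr 7 _U_ _R_

data Formula (n : ℕ) : Set where
  top bot     : Formula n
  atom natom  : Fin n → Formula n
  _∧ᶠ_ _∨ᶠ_   : Formula n → Formula n → Formula n
  X N         : Formula n → Formula n
  _U_ _R_     : Formula n → Formula n → Formula n

-- Finite nonempty traces: positions 0 … last, val i is the set of atoms
-- true at position i (values at positions > last are irrelevant).

record Trace (n : ℕ) : Set where
  field
    last : ℕ
    val  : ℕ → Fin n → Bool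
open Trace public

-- π , i ⊨ φ  (meaningful for i ≤ last π)
_,_⊨_ : ∀ {n} → Trace n → ℕ → Formula n → Set
π , i ⊨ top = ⊤
π , i ⊨ bot = ⊥
π , i ⊨ atom p = val π i p ≡ true
π , i ⊨ natom p = val π i p ≡ false
π , i ⊨ (φ ∧ᶠ ψ) = (π , i ⊨ φ) × (π , i ⊨ ψ)
π , i ⊨ (φ ∨ᶠ ψ) = (π , i ⊨ φ) ⊎ (π , i ⊨ ψ)
π , i ⊨ X φ = (i < last π) × (π , suc i ⊨ φ)
π , i ⊨ N φ = i < last π → π , suc i ⊨ φ
π , i ⊨ (φ U ψ) =
  Σ ℕ λ j → (i ≤ j) × (j ≤ last π) × (π , j ⊨ ψ) ×
            (∀ m → i ≤ m → m < j → π , m ⊨ φ)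
π , i ⊨ (φ R ψ) =
  ∀ j → i ≤ j → j ≤ last π →
    (π , j ⊨ ψ) ⊎ (Σ ℕ λ m → (i ≤ m) × (m < j) × (π , m ⊨ φ))

Satisfiable : ∀ {n} → Formula n → Set
Satisfiable {n} φ = Σ (Trace n) λ π → π , 0 ⊨ φ

-- Propositional abstractions of neXt normal forms: Boolean combinations
-- of literals, the variable Tail (and its negation), and one variable
-- for each formula  X χ  (written  pnext χ).

data PForm (n : ℕ) : Set where
  ptt pff       : PForm n
  pat pnat      : Fin n → PForm n
  ptail pntail  : PForm n
  pnext         : Formula n → PForm n
  _p∧_ _p∨_     : PForm n → PForm n → PForm n

xnf : ∀ {n} → Formula n → PForm n
xnf top = ptt
xnf bot = pff
xnf (atom p) = pat p
xnf (natom p) = pnat p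
xnf (a ∧ᶠ b) = xnf a p∧ xnf b
xnf (a ∨ᶠ b) = xnf a p∨ xnf b
xnf (X a) = pntail p∧ pnext a
xnf (N a) = ptail p∨ pnext a
xnf (a U b) = xnf b p∨ (pntail p∧ (xnf a p∧ pnext (a U b)))
xnf (a R b) = xnf b p∧ (ptail p∨ (xnf a p∨ pnext (a R b)))

-- States of T_φ: finite sets of formulas, represented by lists.
State : ℕ → Set
State n = List (Formula n)

xnfS : ∀ {n} → State n → PForm n
xnfS s = foldr _p∧_ ptt (map xnf s)

record Assign (n : ℕ) : Set where
  field
    atomv : Fin n → Bool
    tailv : Bool
    nextv : Formula n → Bool
open Assign public

evalP : ∀ {n} → Assign n → PForm n → Bool
evalP A ptt = true
evalP A pff = false
evalP A (pat p) = atomv A p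
evalP A (pnat p) = not (atomv A p)
evalP A ptail = tailv A
evalP A pntail = not (tailv A)
evalP A (pnext χ) = nextv A χ
evalP A (θ p∧ θ′) = evalP A θ ∧ evalP A θ′
evalP A (θ p∨ θ′) = evalP A θ ∨ evalP A θ′

xvars : ∀ {n} → PForm n → List (Formula n)
xvars (pnext χ) = [ χ ]
xvars (θ p∧ θ′) = xvars θ ++ xvars θ′
xvars (θ p∨ θ′) = xvars θ ++ xvars θ′
xvars _ = []

Trans : ∀ {n} → State n → State n → Set
Trans s s′ =
  Σ (Assign _) λ A → (evalP A (xnfS s) ≡ true) ×
    (∀ χ → (χ ∈ s′) ⇔ ((χ ∈ xvars (xnfS s)) × (nextv A χ ≡ true)))

Final : ∀ {n} → State n → Set
Final s = Σ (Assign _) λ A → (tailv A ≡ true) × (evalP A (xnfS s) ≡ true)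

StateSet : ℕ → Set₁
StateSet n = State n → Set

-- A conflict sequence C[0], …, C[len-1] for T_φ (entries C i for i ≥ len
-- are ignored).
IsConflictSeq : ∀ {n} → Formula n → (len : ℕ) → (ℕ → StateSet n) → Set
IsConflictSeq φ len C =
  (0 < len) ×
  (∀ i → i < len → C i [ φ ]) ×
  (∀ s → C 0 s → ¬ Final s) ×
  (∀ i → suc i < len → ∀ s → C (suc i) s → ∀ s′ → Trans s s′ → C i s′)

module Submission where

-- The proof rests on the standard property of the transition system T_φ:
-- φ is satisfiable iff the initial state [ φ ] can reach a final state
-- (the inductive predicate ReachesFinal below).  Both directions come from
-- one semantic fact about the neXt normal form: if an assignment A describes
-- position k of a trace (atoms, and whether k is the last position), then
-- xnf ψ is true under A exactly when ψ holds at k, provided the variables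
-- X χ set by A are those with χ holding at k + 1 (xnf-sound/xnf-complete,
-- built on the expansion laws of U and R).  Soundness turns a run to a
-- final state into a trace, position by position from the end; completeness
-- reads a run off a satisfying trace.
--
-- For the theorem: if C[0 … i] has the fixpoint property, the intersection
-- ⋂_{j ≤ i} C[j] contains [ φ ], has no final state and is closed under
-- transitions (a trap), so [ φ ] reaches no final state.  Conversely, for
-- unsatisfiable φ the constant sequence "states reaching no final state",
-- of length 2, is a conflict sequence with fixpoint at i = 0.

open import Defs
open import Data.Nat using (ℕ; zero; suc; _+_; _≤_; _<_; z≤n; s≤s; _≤?_; allUpTo?; anyUpTo?)
  renaming (_≟_ to _≟ℕ_)
open import Data.Nat.Properties
  using (≤-refl; ≤-reflexive; ≤-trans; m≤m+n; <⇒≤; <⇒≢; ≤⇒≯; ≤∧≢⇒<; <-≤-trans; m≤n⇒m<n∨m≡n; m<1+n⇒m≤n; +-suc; +-identityʳ)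
open import Data.Fin using (Fin)
open import Data.Bool using (Bool; true; false; not; _∧_; _∨_)
open import Data.Bool.Properties using (_≟_)
open import Data.List using (List; []; _∷_; _++_; [_]; filter)
open import Data.List.Membership.Propositional using (_∈_)
open import Data.List.Membership.Propositional.Properties using (∈-++⁺ʳ; ∈-filter⁺; ∈-filter⁻)
open import Data.List.Relation.Binary.Subset.Propositional using (_⊆_)
open import Data.List.Relation.Binary.Subset.Propositional.Properties using (xs⊆xs++ys; xs⊆ys++xs)
open import Data.List.Relation.Unary.Any using (here; there)
open import Data.Product using (Σ; _×_; _,_; proj₁; proj₂)
open import Data.Sum using (_⊎_; inj₁; inj₂; map₂)
open import Data.Unit using (tt)
open import Data.Empty using (⊥-elim)
open import Relation.Nullary using (¬_; Dec; yes; no; does)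
open import Relation.Nullary.Decidable using (map′; _×-dec_; _⊎-dec_; _→-dec_; dec-true)
open import Relation.Binary.PropositionalEquality using (_≡_; refl; sym; trans; cong; cong₂; cong-app)
open import Function.Bundles using (_⇔_; mk⇔; Equivalence)

open Equivalence using (to; from)

private
  variable
    n : ℕ

∧-intro : ∀ {a b} → a ≡ true → b ≡ true → a ∧ b ≡ true
∧-intro = cong₂ _∧_

∧-elim : ∀ {a b} → a ∧ b ≡ true → (a ≡ true) × (b ≡ true)
∧-elim {true} {true} _ = refl , refl

∨-introˡ : ∀ {a b} → a ≡ true → a ∨ b ≡ true
∨-introˡ refl = refl

∨-introʳ : ∀ a {b} → b ≡ true → a ∨ b ≡ true
∨-introʳ true _ = refl
∨-introʳ false e = e

∨-elim : ∀ {a b} → a ∨ b ≡ true → (a ≡ true) ⊎ (b ≡ true)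
∨-elim {true} _ = inj₁ refl
∨-elim {false} e = inj₂ e

true≢false : ¬ (true ≡ false)
true≢false ()

not-true : ∀ {a} → not a ≡ true → a ≡ false
not-true {false} _ = refl

does⇒ : ∀ {P : Set} (p? : Dec P) → does p? ≡ true → P
does⇒ (yes p) _ = p

-- In xnf (a U b) and xnf (a R b) the variables are those of xnf b, then
-- those of xnf a, then the recursive next-variable.
middle⊆ : ∀ {A : Set} (xs ys : List A) χ → ys ⊆ xs ++ (ys ++ [ χ ])
middle⊆ xs ys χ m = ∈-++⁺ʳ xs (xs⊆xs++ys ys [ χ ] m)

last∈ : ∀ {A : Set} (xs ys : List A) χ → χ ∈ xs ++ (ys ++ [ χ ])
last∈ xs ys χ = ∈-++⁺ʳ xs (∈-++⁺ʳ ys (here refl))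

module _ {P : ℕ → Set} (P? : ∀ m → Dec (P m)) where

  all-between? : ∀ i v → Dec (∀ m → i ≤ m → m < v → P m)
  all-between? i v =
    map′ (λ h m i≤m m<v → h m<v i≤m) (λ h {m} m<v i≤m → h m i≤m m<v)
         (allUpTo? (λ m → (i ≤? m) →-dec P? m) v)

  any-between? : ∀ i v → Dec (Σ ℕ λ m → (i ≤ m) × (m < v) × P m)
  any-between? i v =
    map′ (λ (m , m<v , i≤m , pm) → m , i≤m , m<v , pm)
         (λ (m , i≤m , m<v , pm) → m , m<v , i≤m , pm)
         (anyUpTo? (λ m → (i ≤? m) ×-dec P? m) v)

_,_⊨?_ : (π : Trace n) (k : ℕ) (ψ : Formula n) → Dec (π , k ⊨ ψ)
π , k ⊨? top = yes tt
π , k ⊨? bot = no λ ()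
π , k ⊨? atom p = val π k p ≟ true
π , k ⊨? natom p = val π k p ≟ false
π , k ⊨? (a ∧ᶠ b) = (π , k ⊨? a) ×-dec (π , k ⊨? b)
π , k ⊨? (a ∨ᶠ b) = (π , k ⊨? a) ⊎-dec (π , k ⊨? b)
π , k ⊨? X a = (suc k ≤? last π) ×-dec (π , suc k ⊨? a)
π , k ⊨? N a = (suc k ≤? last π) →-dec (π , suc k ⊨? a)
π , k ⊨? (a U b) =
  map′ (λ (j , k≤j , j<1+l , hb , ha) → j , k≤j , m<1+n⇒m≤n j<1+l , hb , ha)
       (λ (j , k≤j , j≤l , hb , ha) → j , k≤j , s≤s j≤l , hb , ha)
       (any-between? (λ j → (π , j ⊨? b) ×-dec all-between? (λ m → π , m ⊨? a) k j)
                     k (suc (last π)))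
π , k ⊨? (a R b) =
  map′ (λ h j k≤j j≤l → h j k≤j (s≤s j≤l)) (λ h j k≤j j<1+l → h j k≤j (m<1+n⇒m≤n j<1+l))
       (all-between? (λ j → (π , j ⊨? b) ⊎-dec any-between? (λ m → π , m ⊨? a) k j)
                     k (suc (last π)))

until-expansion : ∀ {π : Trace n} {k} a b → k ≤ last π →
                  π , k ⊨ (a U b) ⇔ π , k ⊨ (b ∨ᶠ (a ∧ᶠ X (a U b)))
until-expansion {π = π} {k} a b k≤l = mk⇔ unfold fold
  where
  unfold : π , k ⊨ (a U b) → π , k ⊨ (b ∨ᶠ (a ∧ᶠ X (a U b)))
  unfold (j , k≤j , j≤l , hb , ha) with m≤n⇒m<n∨m≡n k≤j
  ... | inj₂ refl = inj₁ hb
  ... | inj₁ k<j  = inj₂ (ha k ≤-refl k<j , <-≤-trans k<j j≤l ,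
                          j , k<j , j≤l , hb , λ m k<m m<j → ha m (<⇒≤ k<m) m<j)

  fold : π , k ⊨ (b ∨ᶠ (a ∧ᶠ X (a U b))) → π , k ⊨ (a U b)
  fold (inj₁ hb) = k , ≤-refl , k≤l , hb , λ m k≤m m<k → ⊥-elim (≤⇒≯ k≤m m<k)
  fold (inj₂ (ha , _ , j , k<j , j≤l , hb , ha′)) = j , <⇒≤ k<j , j≤l , hb , ha″
    where
    ha″ : ∀ m → k ≤ m → m < j → π , m ⊨ a
    ha″ m k≤m m<j with m≤n⇒m<n∨m≡n k≤m
    ... | inj₁ k<m  = ha′ m k<m m<j
    ... | inj₂ refl = ha

-- a R b  ≡  b ∧ (a ∨ N (a R b)); choosing the disjunct uses decidability of a.
release-expansion : ∀ {π : Trace n} {k} a b → k ≤ last π →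
                    π , k ⊨ (a R b) ⇔ π , k ⊨ (b ∧ᶠ (a ∨ᶠ N (a R b)))
release-expansion {π = π} {k} a b k≤l = mk⇔ unfold fold
  where
  unfold : π , k ⊨ (a R b) → π , k ⊨ (b ∧ᶠ (a ∨ᶠ N (a R b)))
  unfold h = now (h k ≤-refl k≤l) , later (π , k ⊨? a)
    where
    now : (π , k ⊨ b) ⊎ (Σ ℕ λ m → (k ≤ m) × (m < k) × (π , m ⊨ a)) → π , k ⊨ b
    now (inj₁ hb) = hb
    now (inj₂ (m , k≤m , m<k , _)) = ⊥-elim (≤⇒≯ k≤m m<k)

    later : Dec (π , k ⊨ a) → π , k ⊨ (a ∨ᶠ N (a R b))
    later (yes ha) = inj₁ ha
    later (no ¬ha) = inj₂ λ _ j k<j j≤l → map₂ skip (h j (<⇒≤ k<j) j≤l)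
      where
      skip : ∀ {j} → Σ ℕ (λ m → (k ≤ m) × (m < j) × (π , m ⊨ a)) →
             Σ ℕ (λ m → (suc k ≤ m) × (m < j) × (π , m ⊨ a))
      skip (m , k≤m , m<j , am) with m≤n⇒m<n∨m≡n k≤m
      ... | inj₁ k<m  = m , k<m , m<j , am
      ... | inj₂ refl = ⊥-elim (¬ha am)

  fold : π , k ⊨ (b ∧ᶠ (a ∨ᶠ N (a R b))) → π , k ⊨ (a R b)
  fold (hb , rest) j k≤j j≤l with m≤n⇒m<n∨m≡n k≤j | rest
  ... | inj₂ refl | _ = inj₁ hb
  ... | inj₁ k<j | inj₁ ha = inj₂ (k , ≤-refl , k<j , ha)
  ... | inj₁ k<j | inj₂ hN =
    map₂ (λ (m , k<m , m<j , am) → m , <⇒≤ k<m , m<j , am)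
         (hN (<-≤-trans k<j j≤l) j k<j j≤l)

record Describes (A : Assign n) (π : Trace n) (k : ℕ) : Set where
  field
    atoms   : atomv A ≡ val π k
    inRange : k ≤ last π
    tail    : tailv A ≡ true ⇔ k ≡ last π

module _ {A : Assign n} {π : Trace n} {k : ℕ} (d : Describes A π k) where
  open Describes d

  notTail⇒inner : tailv A ≡ false → k < last π
  notTail⇒inner t = ≤∧≢⇒< inRange λ k≡l → true≢false (trans (sym (from tail k≡l)) t)

  inner⇒notTail : k < last π → not (tailv A) ≡ true
  inner⇒notTail k<l with tailv A in t
  ... | false = refl
  ... | true  = ⊥-elim (<⇒≢ k<l (to tail t))

  Obliged : List (Formula n) → Set
  Obliged xs = ∀ χ → χ ∈ xs → nextv A χ ≡ true → k < last π → π , suc k ⊨ χ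

  restrict : ∀ {xs ys} → Obliged xs → ys ⊆ xs → Obliged ys
  restrict ob ys⊆xs χ χ∈ys = ob χ (ys⊆xs χ∈ys)

  xnf-sound : ∀ ψ → Obliged (xvars (xnf ψ)) → evalP A (xnf ψ) ≡ true → π , k ⊨ ψ
  xnf-sound top ob e = tt
  xnf-sound bot ob ()
  xnf-sound (atom p) ob e = trans (sym (cong-app atoms p)) e
  xnf-sound (natom p) ob e = trans (sym (cong-app atoms p)) (not-true e)
  xnf-sound (a ∧ᶠ b) ob e with ∧-elim e
  ... | ea , eb = xnf-sound a (restrict ob (xs⊆xs++ys _ _)) ea ,
                  xnf-sound b (restrict ob (xs⊆ys++xs _ _)) eb
  xnf-sound (a ∨ᶠ b) ob e with ∨-elim e
  ... | inj₁ ea = inj₁ (xnf-sound a (restrict ob (xs⊆xs++ys _ _)) ea)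
  ... | inj₂ eb = inj₂ (xnf-sound b (restrict ob (xs⊆ys++xs _ _)) eb)
  xnf-sound (X a) ob e with ∧-elim e
  ... | nt , na = k<l , ob a (here refl) na k<l
    where k<l = notTail⇒inner (not-true nt)
  xnf-sound (N a) ob e k<l with ∨-elim e
  ... | inj₁ t  = ⊥-elim (<⇒≢ k<l (to tail t))
  ... | inj₂ na = ob a (here refl) na k<l
  xnf-sound (a U b) ob e = from (until-expansion a b inRange) (expanded (∨-elim e))
    where
    expanded : (evalP A (xnf b) ≡ true) ⊎ (evalP A (pntail p∧ (xnf a p∧ pnext (a U b))) ≡ true) →
               π , k ⊨ (b ∨ᶠ (a ∧ᶠ X (a U b)))
    expanded (inj₁ eb) = inj₁ (xnf-sound b (restrict ob (xs⊆xs++ys _ _)) eb)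
    expanded (inj₂ e′) with ∧-elim e′
    ... | nt , e″ with ∧-elim e″
    ... | ea , na = inj₂ (xnf-sound a (restrict ob (middle⊆ (xvars (xnf b)) (xvars (xnf a)) _)) ea ,
                          k<l , ob (a U b) (last∈ (xvars (xnf b)) (xvars (xnf a)) _) na k<l)
      where k<l = notTail⇒inner (not-true nt)
  xnf-sound (a R b) ob e with ∧-elim e
  ... | eb , e′ = from (release-expansion a b inRange)
                       (xnf-sound b (restrict ob (xs⊆xs++ys _ _)) eb , continued (∨-elim e′))
    where
    continued : (tailv A ≡ true) ⊎ (evalP A (xnf a p∨ pnext (a R b)) ≡ true) →
                π , k ⊨ (a ∨ᶠ N (a R b))
    continued (inj₁ t) = inj₂ λ k<l → ⊥-elim (<⇒≢ k<l (to tail t))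
    continued (inj₂ e″) with ∨-elim e″
    ... | inj₁ ea = inj₁ (xnf-sound a (restrict ob (middle⊆ (xvars (xnf b)) (xvars (xnf a)) _)) ea)
    ... | inj₂ na = inj₂ (ob (a R b) (last∈ (xvars (xnf b)) (xvars (xnf a)) _) na)

  xnf-complete : (∀ χ → π , suc k ⊨ χ → nextv A χ ≡ true) →
                 ∀ ψ → π , k ⊨ ψ → evalP A (xnf ψ) ≡ true
  xnf-complete next top h = refl
  xnf-complete next bot ()
  xnf-complete next (atom p) h = trans (cong-app atoms p) h
  xnf-complete next (natom p) h = cong not (trans (cong-app atoms p) h)
  xnf-complete next (a ∧ᶠ b) (ha , hb) = ∧-intro (xnf-complete next a ha) (xnf-complete next b hb)
  xnf-complete next (a ∨ᶠ b) (inj₁ ha) = ∨-introˡ (xnf-complete next a ha)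
  xnf-complete next (a ∨ᶠ b) (inj₂ hb) = ∨-introʳ (evalP A (xnf a)) (xnf-complete next b hb)
  xnf-complete next (X a) (k<l , ha) = ∧-intro (inner⇒notTail k<l) (next a ha)
  xnf-complete next (N a) h with m≤n⇒m<n∨m≡n inRange
  ... | inj₁ k<l = ∨-introʳ (tailv A) (next a (h k<l))
  ... | inj₂ k≡l = ∨-introˡ (from tail k≡l)
  xnf-complete next (a U b) h with to (until-expansion a b inRange) h
  ... | inj₁ hb = ∨-introˡ (xnf-complete next b hb)
  ... | inj₂ (ha , k<l , hU) =
    ∨-introʳ (evalP A (xnf b))
      (∧-intro (inner⇒notTail k<l) (∧-intro (xnf-complete next a ha) (next (a U b) hU)))
  xnf-complete next (a R b) h with to (release-expansion a b inRange) h
  ... | hb , rest = ∧-intro (xnf-complete next b hb) (continued rest (m≤n⇒m<n∨m≡n inRange))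
    where
    continued : π , k ⊨ (a ∨ᶠ N (a R b)) → k < last π ⊎ k ≡ last π →
                evalP A (ptail p∨ (xnf a p∨ pnext (a R b))) ≡ true
    continued (inj₁ ha) _ = ∨-introʳ (tailv A) (∨-introˡ (xnf-complete next a ha))
    continued (inj₂ _) (inj₂ k≡l) = ∨-introˡ (from tail k≡l)
    continued (inj₂ hN) (inj₁ k<l) =
      ∨-introʳ (tailv A) (∨-introʳ (evalP A (xnf a)) (next (a R b) (hN k<l)))

Holds : Trace n → ℕ → State n → Set
Holds π k s = ∀ χ → χ ∈ s → π , k ⊨ χ

xnfS-elim : ∀ {A : Assign n} s → evalP A (xnfS s) ≡ true → ∀ ψ → ψ ∈ s → evalP A (xnf ψ) ≡ true
xnfS-elim {A = A} (χ ∷ s) e .χ (here refl) = proj₁ (∧-elim {evalP A (xnf χ)} e)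
xnfS-elim {A = A} (χ ∷ s) e ψ (there ψ∈s) = xnfS-elim s (proj₂ (∧-elim {evalP A (xnf χ)} e)) ψ ψ∈s

xnfS-intro : ∀ {A : Assign n} s → (∀ ψ → ψ ∈ s → evalP A (xnf ψ) ≡ true) → evalP A (xnfS s) ≡ true
xnfS-intro [] h = refl
xnfS-intro (ψ ∷ s) h = ∧-intro (h ψ (here refl)) (xnfS-intro s (λ χ m → h χ (there m)))

xvars-state : ∀ {ψ : Formula n} s → ψ ∈ s → xvars (xnf ψ) ⊆ xvars (xnfS s)
xvars-state (_ ∷ s) (here refl) = xs⊆xs++ys _ _
xvars-state (χ ∷ s) (there ψ∈s) m = ∈-++⁺ʳ (xvars (xnf χ)) (xvars-state s ψ∈s m)

data ReachesFinal {n} : State n → Set where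
  final : ∀ {s} → Final s → ReachesFinal s
  step  : ∀ {s s′} → Trans s s′ → ReachesFinal s′ → ReachesFinal s

-- Soundness of T_φ: a run to a final state yields a satisfying trace

point : (Fin n → Bool) → Trace n
point v = record { last = 0 ; val = λ _ → v }

_◃_ : (Fin n → Bool) → Trace n → Trace n
v ◃ π = record { last = suc (last π) ; val = λ { zero → v ; (suc i) → val π i } }

◃-shift : ∀ {v} {π : Trace n} χ i → π , i ⊨ χ → (v ◃ π) , suc i ⊨ χ
◃-shift top i h = h
◃-shift bot i ()
◃-shift (atom p) i h = h
◃-shift (natom p) i h = h
◃-shift (a ∧ᶠ b) i (ha , hb) = ◃-shift a i ha , ◃-shift b i hb
◃-shift (a ∨ᶠ b) i (inj₁ ha) = inj₁ (◃-shift a i ha)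
◃-shift (a ∨ᶠ b) i (inj₂ hb) = inj₂ (◃-shift b i hb)
◃-shift (X a) i (i<l , ha) = s≤s i<l , ◃-shift a (suc i) ha
◃-shift (N a) i h (s≤s i<l) = ◃-shift a (suc i) (h i<l)
◃-shift (a U b) i (j , i≤j , j≤l , hb , ha) =
  suc j , s≤s i≤j , s≤s j≤l , ◃-shift b j hb ,
  λ { (suc m) (s≤s i≤m) (s≤s m<j) → ◃-shift a m (ha m i≤m m<j) }
◃-shift (a R b) i h (suc j) (s≤s i≤j) (s≤s j≤l) with h j i≤j j≤l
... | inj₁ hb = inj₁ (◃-shift b j hb)
... | inj₂ (m , i≤m , m<j , ha) = inj₂ (suc m , s≤s i≤m , s≤s m<j , ◃-shift a m ha)

SatisfiableState : State n → Set
SatisfiableState {n} s = Σ (Trace n) λ π → Holds π 0 s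

final⇒satisfiable : ∀ {s : State n} → Final s → SatisfiableState s
final⇒satisfiable {s = s} (A , t , e) =
  point (atomv A) , λ ψ ψ∈s → xnf-sound describes ψ (λ _ _ _ ()) (xnfS-elim s e ψ ψ∈s)
  where
  describes : Describes A (point (atomv A)) 0
  describes = record { atoms = refl ; inRange = z≤n ; tail = mk⇔ (λ _ → refl) (λ _ → t) }

-- satisfiability propagates backwards along transitions: prepend the
-- position described by the transition's assignment (unless it sets Tail)
transition⇒satisfiable : ∀ {s s′ : State n} → Trans s s′ → SatisfiableState s′ → SatisfiableState s
transition⇒satisfiable {s = s} (A , e , next) (π , hs′) with tailv A in t
... | true  = final⇒satisfiable (A , t , e)
... | false = atomv A ◃ π , λ ψ ψ∈s → xnf-sound describes ψ (obliged ψ∈s) (xnfS-elim s e ψ ψ∈s)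
  where
  describes : Describes A (atomv A ◃ π) 0
  describes = record
    { atoms = refl ; inRange = z≤n ; tail = mk⇔ (λ t′ → ⊥-elim (true≢false (trans (sym t′) t))) (λ ()) }

  obliged : ∀ {ψ} → ψ ∈ s → Obliged describes (xvars (xnf ψ))
  obliged ψ∈s χ χ∈ψ nχ _ = ◃-shift χ 0 (hs′ χ (from (next χ) (xvars-state s ψ∈s χ∈ψ , nχ)))

reachesFinal⇒satisfiable : ∀ {s : State n} → ReachesFinal s → SatisfiableState s
reachesFinal⇒satisfiable (final f) = final⇒satisfiable f
reachesFinal⇒satisfiable (step t r) = transition⇒satisfiable t (reachesFinal⇒satisfiable r)

-- Completeness of T_φ: a satisfying trace yields a run to a final state

assignmentAt : Trace n → ℕ → Assign n
assignmentAt π k = record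
  { atomv = val π k
  ; tailv = does (k ≟ℕ last π)
  ; nextv = λ χ → does (π , suc k ⊨? χ)
  }

assignmentAt-describes : ∀ (π : Trace n) {k} → k ≤ last π → Describes (assignmentAt π k) π k
assignmentAt-describes π {k} k≤l = record
  { atoms = refl ; inRange = k≤l ; tail = mk⇔ (does⇒ (k ≟ℕ last π)) (dec-true (k ≟ℕ last π)) }

holds⇒xnfS : ∀ (π : Trace n) {k} s → k ≤ last π → Holds π k s →
             evalP (assignmentAt π k) (xnfS s) ≡ true
holds⇒xnfS π {k} s k≤l hs =
  xnfS-intro s λ ψ ψ∈s →
    xnf-complete (assignmentAt-describes π k≤l) (λ χ → dec-true (π , suc k ⊨? χ)) ψ (hs ψ ψ∈s)

nextState : Trace n → ℕ → State n → State n
nextState π k s = filter (λ χ → π , suc k ⊨? χ) (xvars (xnfS s))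

holds⇒transition : ∀ (π : Trace n) {k} s → k ≤ last π → Holds π k s →
                   Trans s (nextState π k s) × Holds π (suc k) (nextState π k s)
holds⇒transition π {k} s k≤l hs =
  (assignmentAt π k , holds⇒xnfS π s k≤l hs , λ χ → mk⇔ selected⇒set set⇒selected) ,
  λ χ χ∈next → proj₂ (selected χ∈next)
  where
  selected : ∀ {χ} → χ ∈ nextState π k s → (χ ∈ xvars (xnfS s)) × (π , suc k ⊨ χ)
  selected = ∈-filter⁻ (λ χ → π , suc k ⊨? χ)

  selected⇒set : ∀ {χ} → χ ∈ nextState π k s →
                 (χ ∈ xvars (xnfS s)) × (does (π , suc k ⊨? χ) ≡ true)
  selected⇒set {χ} χ∈next = proj₁ (selected χ∈next) , dec-true (π , suc k ⊨? χ) (proj₂ (selected χ∈next))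

  set⇒selected : ∀ {χ} → (χ ∈ xvars (xnfS s)) × (does (π , suc k ⊨? χ) ≡ true) →
                 χ ∈ nextState π k s
  set⇒selected {χ} (m , e) = ∈-filter⁺ (λ χ → π , suc k ⊨? χ) m (does⇒ (π , suc k ⊨? χ) e)

holds⇒reachesFinal : ∀ (π : Trace n) d k s → k + d ≡ last π → Holds π k s → ReachesFinal s
holds⇒reachesFinal π zero k s k+0≡l hs =
  final (assignmentAt π k , dec-true (k ≟ℕ last π) k≡l , holds⇒xnfS π s (≤-reflexive k≡l) hs)
  where
  k≡l : k ≡ last π
  k≡l = trans (sym (+-identityʳ k)) k+0≡l
holds⇒reachesFinal π (suc d) k s k+1+d≡l hs =
  let (t , hs′) = holds⇒transition π s k≤l hs in
  step t (holds⇒reachesFinal π d (suc k) _ (trans (sym (+-suc k d)) k+1+d≡l) hs′)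
  where
  k≤l : k ≤ last π
  k≤l = ≤-trans (m≤m+n k (suc d)) (≤-reflexive k+1+d≡l)

satisfiable⇔reachesFinal : (φ : Formula n) → Satisfiable φ ⇔ ReachesFinal [ φ ]
satisfiable⇔reachesFinal φ = mk⇔
  (λ (π , h) → holds⇒reachesFinal π (last π) 0 [ φ ] refl λ { _ (here refl) → h })
  (λ r → let (π , h) = reachesFinal⇒satisfiable r in π , h φ (here refl))

record Trap (D : StateSet n) : Set where
  field
    noFinal : ∀ {s} → D s → ¬ Final s
    closed  : ∀ {s s′} → D s → Trans s s′ → D s′

trap-avoids : ∀ {D : StateSet n} → Trap D → ∀ {s} → D s → ¬ ReachesFinal s
trap-avoids D-trap Ds (final f) = Trap.noFinal D-trap Ds f
trap-avoids D-trap Ds (step t r) = trap-avoids D-trap (Trap.closed D-trap Ds t) r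

⋂≤ : (ℕ → StateSet n) → ℕ → StateSet n
⋂≤ C i s = ∀ j → j ≤ i → C j s

-- If C[0 … i] is a prefix of a conflict sequence with ⋂_{j ≤ i} C[j] ⊆ C[i+1],
-- that intersection is a trap: a step from it lands in C[j] for each j ≤ i,
-- because its source lies in C[j+1] (by the fixpoint property when j = i).
fixpoint⇒trap : ∀ {φ : Formula n} {len C i} → IsConflictSeq φ len C → suc i < len →
                (∀ s → ⋂≤ C i s → C (suc i) s) → Trap (⋂≤ C i)
fixpoint⇒trap {C = C} {i} (_ , _ , noFinal₀ , successors) 1+i<len fixpoint = record
  { noFinal = λ Ds → noFinal₀ _ (Ds 0 z≤n)
  ; closed  = λ {s} Ds t j j≤i →
      successors j (≤-trans (s≤s (s≤s j≤i)) 1+i<len) s (in-next Ds (m≤n⇒m<n∨m≡n j≤i)) _ t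
  }
  where
  in-next : ∀ {s j} → ⋂≤ C i s → j < i ⊎ j ≡ i → C (suc j) s
  in-next Ds (inj₁ j<i) = Ds _ j<i
  in-next {s} Ds (inj₂ refl) = fixpoint s Ds

initial∈⋂≤ : ∀ {φ : Formula n} {len C i} → IsConflictSeq φ len C → suc i < len → ⋂≤ C i [ φ ]
initial∈⋂≤ (_ , initial , _) 1+i<len j j≤i = initial j (≤-trans (s≤s j≤i) (<⇒≤ 1+i<len))

unreachable-conflictSeq : (φ : Formula n) → ¬ ReachesFinal [ φ ] →
                          IsConflictSeq φ 2 (λ _ s → ¬ ReachesFinal s)
unreachable-conflictSeq φ unreachable =
  s≤s z≤n , (λ _ _ → unreachable) , (λ _ ¬r f → ¬r (final f)) ,
  (λ _ _ _ ¬r _ t r′ → ¬r (step t r′))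

mainTheorem3 : ∀ {n} (φ : Formula n) →
    (¬ Satisfiable φ) ⇔
      (Σ ℕ λ len → Σ (ℕ → StateSet n) λ C →
        IsConflictSeq φ len C ×
        (Σ ℕ λ i → (suc i < len) ×
          (∀ s → (∀ j → j ≤ i → C j s) → C (suc i) s)))
mainTheorem3 φ = mk⇔
  (λ unsat →
    2 , (λ _ s → ¬ ReachesFinal s) ,
    unreachable-conflictSeq φ (λ r → unsat (from (satisfiable⇔reachesFinal φ) r)) ,
    0 , s≤s (s≤s z≤n) , (λ s ⋂₀ → ⋂₀ 0 z≤n))
  (λ (len , C , conflict , i , 1+i<len , fixpoint) sat →
    trap-avoids (fixpoint⇒trap conflict 1+i<len fixpoint)
                (initial∈⋂≤ conflict 1+i<len)
                (to (satisfiable⇔reachesFinal φ) sat))
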